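{- For every deterministic online flow scheduling algorithm $\mathcal{A}$ there is an instance $I$ of flow scheduling (with unit demands and unit port capacities) such that the maximum response time of the schedule produced by $\mathcal{A}$ on $I$ is at least $3/2$ times the optimal maximum response time of $I$.
   Context: A flow scheduling instance is a switch: a finite set of input ports and output ports, each port $p$ having a positive integer capacity $c_p$, and a finite set $F$ of flows, each flow $e=pq$ going from an input port $p$ to an output port $q$ with a demand $d_e\le\min(c_p,c_q)$ and a release time $r_e\in\mathbb{N}$ (time is divided into integer rounds). A schedule is a function $\sigma:F\times\mathbb{N}\to\{0,1\}$ such that for every flow $e$ there is some $t$ with $\sigma(e,t)=1$; $\sigma(e,t)=1$ implies $t\ge r_e$; and for every port $p$ and round $t$, $\sum_{e\ni p} d_e\sigma(e,t)\le c_p$. The completion time of $e$ is $C_e=1+\min\{t:\sigma(e,t)=1\}$ and its response time is $\rho_e=C_e-r_e$; the maximum response time of a schedule is $\max_e\rho_e$. An online algorithm learns of each flow only at its release time, and decides which flows to schedule in round $t$ (irrevocably) based only on the flows released at or before round $t$. -}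

module Defs where

open import Data.Nat using (ℕ; zero; suc; _+_; _*_; _∸_; _≤_; _≤ᵇ_; _≡ᵇ_)
open import Data.Bool using (Bool; true; false; if_then_else_; _∧_)
open import Data.List using (List; []; _∷_; length; lookup; map)
open import Data.Nat.ListAction using (sum)
open import Data.Fin using (Fin; zero; suc)
open import Data.List using (allFin)
open import Data.Product using (Σ; ∃; _×_; _,_)
open import Relation.Binary.PropositionalEquality using (_≡_)

-- Input ports and output ports are each named by natural numbers
-- (the two kinds are kept apart by the fields src / dst).
-- Every demand and every capacity equals 1.
record Flow : Set where
  constructor flow
  field
    src : ℕ
    dst : ℕ
    rel : ℕ

open Flow public

Instance : Set
Instance = List Flow

FlowOf : Instance → Set
FlowOf I = Fin (length I)

Schedule : Instance → Set
Schedule I = FlowOf I → ℕ → Bool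

inLoad : (I : Instance) → Schedule I → ℕ → ℕ → ℕ
inLoad I σ p t =
  sum (map (λ e → if σ e t ∧ (src (lookup I e) ≡ᵇ p) then 1 else 0) (allFin (length I)))

outLoad : (I : Instance) → Schedule I → ℕ → ℕ → ℕ
outLoad I σ q t =
  sum (map (λ e → if σ e t ∧ (dst (lookup I e) ≡ᵇ q) then 1 else 0) (allFin (length I)))

IsSchedule : (I : Instance) → Schedule I → Set
IsSchedule I σ =
  (∀ e → ∃ λ t → σ e t ≡ true)
  × (∀ e t → σ e t ≡ true → rel (lookup I e) ≤ t)
  × (∀ p t → inLoad I σ p t ≤ 1)
  × (∀ q t → outLoad I σ q t ≤ 1)

-- The maximum response time of σ is at most K:
-- every flow e has a round t with σ(e,t)=1 and (t+1) - r_e ≤ K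
-- (equivalently ρ_e = C_e - r_e ≤ K, as C_e = 1 + min{t : σ(e,t)=1}).
MaxResponseAtMost : (I : Instance) → Schedule I → ℕ → Set
MaxResponseAtMost I σ K = ∀ e → ∃ λ t → (σ e t ≡ true) × (suc t ∸ rel (lookup I e) ≤ K)

visible : ℕ → Instance → Instance
visible t [] = []
visible t (f ∷ I) = if rel f ≤ᵇ t then f ∷ visible t I else visible t I

-- A deterministic online algorithm: in round t it sees exactly the list of
-- flows released at or before t and decides (irrevocably) which of them to
-- schedule in round t.  (Its own earlier decisions are recomputable from
-- the earlier visible lists, which are sublists of the current one.)
OnlineAlgorithm : Set
OnlineAlgorithm = (t : ℕ) → (vis : Instance) → Fin (length vis) → Bool

liftDecision : (t : ℕ) (I : Instance) → (Fin (length (visible t I)) → Bool) → FlowOf I → Bool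
liftDecision t [] m ()
liftDecision t (f ∷ I) m e with rel f ≤ᵇ t
liftDecision t (f ∷ I) m zero    | true  = m zero
liftDecision t (f ∷ I) m (suc e) | true  = liftDecision t I (λ i → m (suc i)) e
liftDecision t (f ∷ I) m zero    | false = false
liftDecision t (f ∷ I) m (suc e) | false = liftDecision t I m e

run : OnlineAlgorithm → (I : Instance) → Schedule I
run A I e t = liftDecision t I (A t (visible t I)) e

ValidAlgorithm : OnlineAlgorithm → Set
ValidAlgorithm A = ∀ I → IsSchedule I (run A I)

module Submission where

-- The adversary starts with two flows a = (0→0) and b = (0→1),
-- released in round 0.  They share input port 0, so the algorithm runs at most
-- one of them in round 0; call the other one the late flow.  In round 1 the
-- adversary releases two more flows c, d into the output port of the late
-- flow.  Offline, running the late flow in round 0 gives maximum response 2.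
-- Online, three flows compete for one output port from round 1 on, so one of
-- them has response time at least 3, and 3·2 ≤ 2·3.

open import Defs
open import Data.Nat using (ℕ; zero; suc; _+_; _*_; _∸_; _≤_; _<_; _≡ᵇ_; z≤n; s≤s)
open import Data.Nat.Properties
  using (≡ᵇ⇒≡; ≡⇒≡ᵇ; ≤-refl; ≤-trans; m≤n+m; ≤∧≢⇒<; m+n≤o⇒m≤o∸n; *-monoʳ-≤; _≤?_)
  renaming (_≟_ to _≟ℕ_)
open import Data.Nat.ListAction using (sum)
open import Data.Bool using (Bool; true; false; if_then_else_; _∧_)
open import Data.Bool.Properties using (T-≡; ∧-conicalˡ; ∧-conicalʳ; not-¬)
open import Data.Fin using (Fin; zero; suc)
open import Data.Fin.Properties using (all?; 0≢1+n; suc-injective) renaming (_≟_ to _≟F_)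
open import Data.List using ([]; _∷_; lookup; map; allFin)
open import Data.List.Properties using (map-tabulate)
open import Data.Empty using (⊥-elim)
open import Data.Product using (Σ; ∃; _×_; _,_; proj₁; proj₂; map₂)
open import Function using (_∘_; id)
open import Function.Bundles using (Equivalence)
open import Relation.Binary.PropositionalEquality
  using (_≡_; _≢_; refl; sym; trans; cong; cong₂; subst)
open import Relation.Nullary using (Dec; yes; no; ¬_)
open import Relation.Nullary.Decidable using (_×-dec_; _→-dec_; toWitness)

≡ᵇ-complete : ∀ m n → m ≡ n → (m ≡ᵇ n) ≡ true
≡ᵇ-complete m n eq = Equivalence.to T-≡ (≡⇒≡ᵇ m n eq)

≡ᵇ-sound : ∀ m n → (m ≡ᵇ n) ≡ true → m ≡ n
≡ᵇ-sound m n h = ≡ᵇ⇒≡ m n (Equivalence.from T-≡ h)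

-- Number of indices satisfying a Boolean predicate; every port load in Defs
-- is definitionally such a count.
count : ∀ {n} → (Fin n → Bool) → ℕ
count {n} P = sum (map (λ i → if P i then 1 else 0) (allFin n))

count-suc : ∀ {n} (P : Fin (suc n) → Bool) →
  count P ≡ (if P zero then 1 else 0) + count (P ∘ suc)
count-suc P = cong (λ xs → (if P zero then 1 else 0) + sum xs)
  (trans (map-tabulate suc indicator) (sym (map-tabulate id (indicator ∘ suc))))
  where
  indicator : Fin _ → ℕ
  indicator i = if P i then 1 else 0

count-≥1 : ∀ {n} (P : Fin n → Bool) {i} → P i ≡ true → 1 ≤ count P
count-≥1 P {zero} Pi rewrite count-suc P | Pi = s≤s z≤n
count-≥1 P {suc i} Pi rewrite count-suc P =
  ≤-trans (count-≥1 (P ∘ suc) Pi) (m≤n+m _ _)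

count-≥2 : ∀ {n} (P : Fin n → Bool) {i j} → i ≢ j → P i ≡ true → P j ≡ true → 2 ≤ count P
count-≥2 P {zero} {zero} i≢j _ _ = ⊥-elim (i≢j refl)
count-≥2 P {zero} {suc j} _ Pi Pj rewrite count-suc P | Pi = s≤s (count-≥1 (P ∘ suc) Pj)
count-≥2 P {suc i} {zero} _ Pi Pj rewrite count-suc P | Pj = s≤s (count-≥1 (P ∘ suc) Pi)
count-≥2 P {suc i} {suc j} i≢j Pi Pj rewrite count-suc P =
  ≤-trans (count-≥2 (P ∘ suc) (i≢j ∘ cong suc) Pi Pj) (m≤n+m _ _)

count-none : ∀ {n} (P : Fin n → Bool) → (∀ i → P i ≢ true) → count P ≡ 0
count-none {zero} P none = refl
count-none {suc n} P none rewrite count-suc P with P zero in P0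
... | true = ⊥-elim (none zero P0)
... | false = count-none (P ∘ suc) (none ∘ suc)

count-≤1 : ∀ {n} (P : Fin n → Bool) → (∀ i j → P i ≡ true → P j ≡ true → i ≡ j) → count P ≤ 1
count-≤1 {zero} P unique = z≤n
count-≤1 {suc n} P unique rewrite count-suc P with P zero in P0
... | true rewrite count-none (P ∘ suc) (λ j Pj → 0≢1+n (unique zero (suc j) P0 Pj)) = ≤-refl
... | false = count-≤1 (P ∘ suc) (λ i j Pi Pj → suc-injective (unique (suc i) (suc j) Pi Pj))

-- Load of a port in round t, for either end of the flows (src or dst);
-- inLoad and outLoad are the instances end = src and end = dst.
portLoad : (I : Instance) → Schedule I → (Flow → ℕ) → ℕ → ℕ → ℕ
portLoad I σ end p t = count (λ e → σ e t ∧ (end (lookup I e) ≡ᵇ p))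

Respects : (I : Instance) → Schedule I → (Flow → ℕ) → Set
Respects I σ end = ∀ {e e′ t} → σ e t ≡ true → σ e′ t ≡ true →
  end (lookup I e) ≡ end (lookup I e′) → e ≡ e′

respects⇒load≤1 : ∀ {I σ} end → Respects I σ end → ∀ p t → portLoad I σ end p t ≤ 1
respects⇒load≤1 end respects p t = count-≤1 _ λ e e′ he he′ →
  respects (∧-conicalˡ _ _ he) (∧-conicalˡ _ _ he′)
    (trans (≡ᵇ-sound _ p (∧-conicalʳ _ _ he)) (sym (≡ᵇ-sound _ p (∧-conicalʳ _ _ he′))))

load≤1⇒respects : ∀ {I σ} end → (∀ p t → portLoad I σ end p t ≤ 1) → Respects I σ end
load≤1⇒respects {I} {σ} end bounded {e} {e′} {t} he he′ same with e ≟F e′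
... | yes e≡e′ = e≡e′
... | no e≢e′ = ⊥-elim (2≰1 (≤-trans
        (count-≥2 (λ k → σ k t ∧ (end (lookup I k) ≡ᵇ port)) e≢e′
          (cong₂ _∧_ he (≡ᵇ-complete port port refl))
          (cong₂ _∧_ he′ (≡ᵇ-complete (end (lookup I e′)) port (sym same))))
        (bounded port t)))
  where
  port : ℕ
  port = end (lookup I e)
  2≰1 : ¬ (2 ≤ 1)
  2≰1 (s≤s ())

inRespects : ∀ {I σ} → IsSchedule I σ → Respects I σ src
inRespects {I} {σ} (_ , _ , inBound , _) = load≤1⇒respects {I} {σ} src inBound

outRespects : ∀ {I σ} → IsSchedule I σ → Respects I σ dst
outRespects {I} {σ} (_ , _ , _ , outBound) = load≤1⇒respects {I} {σ} dst outBound

slotted : (I : Instance) → (FlowOf I → ℕ) → Schedule I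
slotted I slot e t = slot e ≡ᵇ t

Separated : (I : Instance) → (FlowOf I → ℕ) → (Flow → ℕ) → Set
Separated I slot end = ∀ e e′ → slot e ≡ slot e′ → end (lookup I e) ≡ end (lookup I e′) → e ≡ e′

Admissible : (I : Instance) → (FlowOf I → ℕ) → ℕ → Set
Admissible I slot K =
  (∀ e → rel (lookup I e) ≤ slot e) × (∀ e → suc (slot e) ∸ rel (lookup I e) ≤ K) ×
  Separated I slot src × Separated I slot dst

admissible? : ∀ I slot K → Dec (Admissible I slot K)
admissible? I slot K =
  all? (λ e → rel (lookup I e) ≤? slot e) ×-dec
  all? (λ e → suc (slot e) ∸ rel (lookup I e) ≤? K) ×-dec
  separated? src ×-dec separated? dst
  where
  separated? : ∀ end → Dec (Separated I slot end)
  separated? end = all? λ e → all? λ e′ →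
    (slot e ≟ℕ slot e′) →-dec (end (lookup I e) ≟ℕ end (lookup I e′)) →-dec (e ≟F e′)

slotted-runs : ∀ {I} slot {e t} → slotted I slot e t ≡ true → slot e ≡ t
slotted-runs slot {e} {t} = ≡ᵇ-sound (slot e) t

slotted-at-slot : ∀ {I} slot e → slotted I slot e (slot e) ≡ true
slotted-at-slot slot e = ≡ᵇ-complete (slot e) (slot e) refl

slotted-schedule : ∀ {I slot K} → Admissible I slot K → IsSchedule I (slotted I slot)
slotted-schedule {I} {slot} (released , _ , srcSeparated , dstSeparated) =
  (λ e → slot e , slotted-at-slot {I} slot e) ,
  (λ e t runs → subst (rel (lookup I e) ≤_) (slotted-runs {I} slot runs) (released e)) ,
  respects⇒load≤1 {I} {slotted I slot} src (matching src srcSeparated) ,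
  respects⇒load≤1 {I} {slotted I slot} dst (matching dst dstSeparated)
  where
  matching : ∀ end → Separated I slot end → Respects I (slotted I slot) end
  matching end separated {e} {e′} he he′ =
    separated e e′ (trans (slotted-runs {I} slot he) (sym (slotted-runs {I} slot he′)))

slotted-response : ∀ {I slot K} → Admissible I slot K → MaxResponseAtMost I (slotted I slot) K
slotted-response {I} {slot} (_ , responds , _) e = slot e , slotted-at-slot {I} slot e , responds e

ResponseAtLeast : (I : Instance) → Schedule I → FlowOf I → ℕ → Set
ResponseAtLeast I σ e k = ∀ t → σ e t ≡ true → k ≤ suc t ∸ rel (lookup I e)

module FeasibleSchedule {I : Instance} {σ : Schedule I} (feasible : IsSchedule I σ) where

  -- A flow released in round r that is idle in rounds r and r+1 has response
  -- time at least 3, since it cannot run before its release.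
  idleTwoRounds : ∀ {e r} → rel (lookup I e) ≡ r →
    σ e r ≢ true → σ e (suc r) ≢ true → ResponseAtLeast I σ e 3
  idleTwoRounds {e} refl idle₀ idle₁ t runs = m+n≤o⇒m≤o∸n 3 (s≤s r+1<t)
    where
    runsAt : ∀ {u} → u ≡ t → σ e u ≡ true
    runsAt refl = runs
    r<t : rel (lookup I e) < t
    r<t = ≤∧≢⇒< (proj₁ (proj₂ feasible) e t runs) (idle₀ ∘ runsAt)
    r+1<t : suc (rel (lookup I e)) < t
    r+1<t = ≤∧≢⇒< r<t (idle₁ ∘ runsAt)

  blocks : ∀ {e e′ t} → e ≢ e′ →
    dst (lookup I e) ≡ dst (lookup I e′) → σ e t ≡ true → σ e′ t ≢ true
  blocks e≢e′ same he he′ = e≢e′ (outRespects {I} {σ} feasible he he′ same)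

  congestion : ∀ {e₁ e₂ e₃} → e₁ ≢ e₂ → e₁ ≢ e₃ → e₂ ≢ e₃ →
    dst (lookup I e₁) ≡ dst (lookup I e₂) → dst (lookup I e₂) ≡ dst (lookup I e₃) →
    rel (lookup I e₁) ≡ 0 → rel (lookup I e₂) ≡ 1 → rel (lookup I e₃) ≡ 1 →
    σ e₁ 0 ≢ true → ∃ λ e → ResponseAtLeast I σ e 3
  congestion {e₁} {e₂} {e₃} e₁≢e₂ e₁≢e₃ e₂≢e₃ port₁₂ port₂₃ rel₁ rel₂ rel₃ idle
    with σ e₁ 1 in run₁
  ... | false = e₁ , idleTwoRounds rel₁ idle (not-¬ run₁)
  ... | true with σ e₂ 2 in run₂
  ...   | false = e₂ , idleTwoRounds rel₂ (blocks e₁≢e₂ port₁₂ run₁) (not-¬ run₂)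
  ...   | true = e₃ , idleTwoRounds rel₃
                       (blocks e₁≢e₃ (trans port₁₂ port₂₃) run₁) (blocks e₂≢e₃ port₂₃ run₂)

flowA flowB : Flow
flowA = flow 0 0 0
flowB = flow 0 1 0

latePort : Bool → ℕ
latePort bLate = if bLate then 1 else 0

trap : Bool → Instance
trap bLate = flowA ∷ flowB ∷ flow 2 (latePort bLate) 1 ∷ flow 3 (latePort bLate) 1 ∷ []

lateFlow : (bLate : Bool) → FlowOf (trap bLate)
lateFlow true = suc zero
lateFlow false = zero

-- Offline the late flow goes first: it runs in round 0, the other round-0
-- flow and the first round-1 flow in round 1, the last flow in round 2.
offlineSlot : (bLate : Bool) → FlowOf (trap bLate) → ℕ
offlineSlot true zero = 1
offlineSlot true (suc zero) = 0
offlineSlot false zero = 0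
offlineSlot false (suc zero) = 1
offlineSlot _ (suc (suc zero)) = 1
offlineSlot _ (suc (suc (suc zero))) = 2

offline-admissible : ∀ bLate → Admissible (trap bLate) (offlineSlot bLate) 2
offline-admissible true = toWitness {a? = admissible? (trap true) (offlineSlot true) 2} _
offline-admissible false = toWitness {a? = admissible? (trap false) (offlineSlot false) 2} _

-- The adversary: in round 0 the algorithm only sees flowA and flowB, and by
-- the input-port constraint it leaves one of them idle; that one is made late.
adversary : (A : OnlineAlgorithm) → ValidAlgorithm A →
  Σ Bool λ bLate → run A (trap bLate) (lateFlow bLate) 0 ≢ true
adversary A valid with A 0 (flowA ∷ flowB ∷ []) (suc zero) in bRuns
... | false = true , not-¬ bRuns
... | true = false , λ aRuns → 0≢1+n (inRespects {trap false} {run A (trap false)}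
                                        (valid (trap false)) {zero} {suc zero} aRuns bRuns refl)

online-late : (A : OnlineAlgorithm) → ValidAlgorithm A → ∀ bLate →
  run A (trap bLate) (lateFlow bLate) 0 ≢ true →
  ∃ λ e → ResponseAtLeast (trap bLate) (run A (trap bLate)) e 3
online-late A valid true = FeasibleSchedule.congestion (valid (trap true))
  {lateFlow true} {suc (suc zero)} {suc (suc (suc zero))} (λ ()) (λ ()) (λ ()) refl refl refl refl refl
online-late A valid false = FeasibleSchedule.congestion (valid (trap false))
  {lateFlow false} {suc (suc zero)} {suc (suc (suc zero))} (λ ()) (λ ()) (λ ()) refl refl refl refl refl

lemma5p2 : (A : OnlineAlgorithm) → ValidAlgorithm A →
    Σ Instance λ I → Σ (Schedule I) λ τ → Σ ℕ λ K →
    IsSchedule I τ × MaxResponseAtMost I τ K ×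
    (∃ λ e → ∀ t → run A I e t ≡ true → 3 * K ≤ 2 * (suc t ∸ rel (lookup I e)))
lemma5p2 A valid with adversary A valid
... | bLate , idle =
  trap bLate , slotted (trap bLate) (offlineSlot bLate) , 2 ,
  slotted-schedule offline , slotted-response offline ,
  map₂ (λ late t runs → *-monoʳ-≤ 2 (late t runs)) (online-late A valid bLate idle)
  where
  offline : Admissible (trap bLate) (offlineSlot bLate) 2
  offline = offline-admissible bLate
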